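{- Let $G$ be a finite DAG with leaf set $X$ that satisfies (PCC), and let $k\ge1$. Then $G$ has the $k$-$\mathrm{lca}$-property if and only if $\mathscr{C}_G$ is pre-$k$-ary.
   Context: For a finite DAG $G$, write $v\preceq w$ if there is a directed path (possibly of length $0$) from $w$ to $v$; the leaf set $X$ is the set of $\preceq$-minimal vertices; $\mathrm{C}(v)=\{x\in X\mid x\preceq v\}$ and $\mathscr{C}_G=\{\mathrm{C}(v)\mid v\in V(G)\}$. $G$ satisfies (PCC) if for all $u,v\in V(G)$: $u$ and $v$ are $\preceq$-comparable if and only if $\mathrm{C}(u)\subseteq\mathrm{C}(v)$ or $\mathrm{C}(v)\subseteq\mathrm{C}(u)$. $X^{(k)}$ is the set of non-empty subsets of $X$ of size at most $k$. A least common ancestor of $Y\subseteq V(G)$ is a $\preceq$-minimal element of the set of common ancestors of all elements of $Y$; $\mathrm{lca}(Y)$ is defined if there is exactly one such vertex. $G$ has the $k$-$\mathrm{lca}$-property if $\mathrm{lca}(A)$ is defined for all $A\in X^{(k)}$. A set system $\mathscr{C}$ on $X$ is pre-$k$-ary if $\bigcap\{C\in\mathscr{C}\mid U\subseteq C\}\in\mathscr{C}$ for every $U\in X^{(k)}$. -}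

module Defs where

open import Data.Nat using (ℕ; _≤_)
open import Data.Bool using (Bool; true)
open import Data.Fin using (Fin)
open import Data.Fin.Subset using (Subset; _∈_; Nonempty; ∣_∣)
open import Data.Product using (Σ; _×_; ∃)
open import Data.Sum using (_⊎_)
open import Data.Empty using (⊥)
open import Relation.Binary.PropositionalEquality using (_≡_)
open import Relation.Binary.Construct.Closure.ReflexiveTransitive using (Star)
open import Relation.Binary.Construct.Closure.Transitive using (TransClosure)
open import Function.Bundles using (_⇔_)

record Digraph : Set where
  field
    n    : ℕ
    edge : Fin n → Fin n → Bool

module _ (G : Digraph) where
  open Digraph G

  Arc : Fin n → Fin n → Set
  Arc u v = edge u v ≡ true

  IsDAG : Set
  IsDAG = ∀ v → TransClosure Arc v v → ⊥

  _≼_ : Fin n → Fin n → Set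
  v ≼ w = Star Arc w v

  IsLeaf : Fin n → Set
  IsLeaf x = ∀ y → y ≼ x → y ≡ x

  C : Fin n → Fin n → Set
  C v x = IsLeaf x × x ≼ v

  _⊆ᶜ_ : (Fin n → Set) → (Fin n → Set) → Set
  P ⊆ᶜ Q = ∀ x → P x → Q x

  PCC : Set
  PCC = ∀ u v → (u ≼ v ⊎ v ≼ u) ⇔ (C u ⊆ᶜ C v ⊎ C v ⊆ᶜ C u)

  In𝒞 : (Fin n → Set) → Set
  In𝒞 P = ∃ λ v → ∀ x → P x ⇔ C v x

  InXk : ℕ → Subset n → Set
  InXk k U = (∀ x → x ∈ U → IsLeaf x) × Nonempty U × ∣ U ∣ ≤ k

  -- ⋂ { C ∈ 𝒞_G | U ⊆ C }, as a subset of X (empty intersection = X)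
  Hull : Subset n → Fin n → Set
  Hull U x = IsLeaf x × (∀ v → (∀ y → y ∈ U → C v y) → C v x)

  PreKary : ℕ → Set
  PreKary k = ∀ U → InXk k U → In𝒞 (Hull U)

  IsCommonAnc : Subset n → Fin n → Set
  IsCommonAnc Y w = ∀ y → y ∈ Y → y ≼ w

  IsLCA : Subset n → Fin n → Set
  IsLCA Y w = IsCommonAnc Y w × (∀ w′ → IsCommonAnc Y w′ → w′ ≼ w → w′ ≡ w)

  LcaDefined : Subset n → Set
  LcaDefined Y = ∃ λ w → IsLCA Y w × (∀ w′ → IsLCA Y w′ → w′ ≡ w)

  KLcaProperty : ℕ → Set
  KLcaProperty k = ∀ A → InXk k A → LcaDefined A

-- Reachability in a finite DAG is decidable and well-founded, so every common
-- ancestor of A lies above some lca of A.  If lca(A) is unique, it therefore lies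
-- below every vertex whose cluster contains A, which makes C(lca A) the
-- intersection of all such clusters.  Conversely, if that intersection is C(v),
-- then v is a common ancestor, and every lca w of A has C(w) = C(v): one inclusion
-- because A ⊆ C(w), the other because (PCC) makes v and w comparable, where v ≼ w
-- forces v = w by minimality of w.  Two lcas with equal clusters are comparable by
-- (PCC), hence equal by minimality.
module Submission where

open import Defs hiding (_≼_; _⊆ᶜ_)
import Defs
open import Data.Nat using (ℕ; _≤_)
open import Data.Bool using (true)
open import Data.Bool.Properties using () renaming (_≟_ to _≟ᵇ_)
open import Data.Empty using (⊥-elim)
open import Data.Fin using (Fin; _≟_)
open import Data.Fin.Induction using (spo-noetherian)
open import Data.Fin.Properties using (any?; all?)
open import Data.Fin.Subset using (_∈_)
open import Data.Fin.Subset.Properties using (_∈?_)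
open import Data.Product using (∃; _×_; _,_; proj₁; proj₂)
open import Data.Sum using (_⊎_; inj₁; inj₂)
open import Function using (flip; _∘_)
open import Function.Bundles using (_⇔_; mk⇔; Equivalence)
open import Induction.WellFounded using (WellFounded; Acc; acc)
open import Level using (0ℓ)
open import Relation.Binary using (Rel; Decidable; IsStrictPartialOrder)
open import Relation.Binary.Construct.Closure.ReflexiveTransitive using (Star; ε; _◅_; _◅◅_)
open import Relation.Binary.Construct.Closure.Transitive using (TransClosure; [_]; _∷_; _++_)
open import Relation.Binary.PropositionalEquality
  using (_≡_; _≢_; refl; sym; isEquivalence; resp₂)
open import Relation.Nullary using (Dec; yes; no; ¬_)
open import Relation.Nullary.Decidable using (map′; _×-dec_; _→-dec_; ¬?; decidable-stable)
import Relation.Unary as U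

open Equivalence using (to; from)

module Acyclic {n : ℕ} {_⟶_ : Rel (Fin n) 0ℓ} (_⟶?_ : Decidable _⟶_)
               (acyclic : ∀ v → ¬ TransClosure _⟶_ v v) where

  _⟶⁺_ _⟶*_ : Rel (Fin n) 0ℓ
  _⟶⁺_ = TransClosure _⟶_
  _⟶*_ = Star _⟶_

  ◅⇒⟶⁺ : ∀ {u v w} → u ⟶ v → v ⟶* w → u ⟶⁺ w
  ◅⇒⟶⁺ e ε       = [ e ]
  ◅⇒⟶⁺ e (f ◅ p) = e ∷ ◅⇒⟶⁺ f p

  ⟶*-≢⇒⟶⁺ : ∀ {u v} → u ⟶* v → u ≢ v → u ⟶⁺ v
  ⟶*-≢⇒⟶⁺ ε       u≢u = ⊥-elim (u≢u refl)
  ⟶*-≢⇒⟶⁺ (e ◅ p) _   = ◅⇒⟶⁺ e p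

  ⟶⁺-isStrictPartialOrder : IsStrictPartialOrder _≡_ _⟶⁺_
  ⟶⁺-isStrictPartialOrder = record
    { isEquivalence = isEquivalence
    ; irrefl        = λ { refl → acyclic _ }
    ; trans         = _++_
    ; <-resp-≈      = resp₂ _⟶⁺_
    }

  ⟶⁺-noetherian : WellFounded (flip _⟶⁺_)
  ⟶⁺-noetherian = spo-noetherian ⟶⁺-isStrictPartialOrder

  _⟶*?_ : Decidable _⟶*_
  u ⟶*? w = go u (⟶⁺-noetherian u)
    where
      go : ∀ u → Acc (flip _⟶⁺_) u → Dec (u ⟶* w)
      go u (acc rec) with u ≟ w
      ... | yes refl = yes ε
      ... | no u≢w = map′ (λ (_ , e , p) → e ◅ p) (λ { ε → ⊥-elim (u≢w refl) ; (e ◅ p) → _ , e , p })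
                          (any? through)
        where
          through : ∀ v → Dec (u ⟶ v × v ⟶* w)
          through v with u ⟶? v
          ... | yes e = map′ (e ,_) proj₂ (go v (rec [ e ]))
          ... | no ¬e = no (¬e ∘ proj₁)

  minimal-below : ∀ {p} (P : U.Pred (Fin n) p) → U.Decidable P → ∀ {v} → P v →
    ∃ λ w → P w × v ⟶* w × (∀ w′ → P w′ → w ⟶* w′ → w′ ≡ w)
  minimal-below P P? {v} pv = go v (⟶⁺-noetherian v) pv
    where
      go : ∀ v → Acc (flip _⟶⁺_) v → P v →
           ∃ λ w → P w × v ⟶* w × (∀ w′ → P w′ → w ⟶* w′ → w′ ≡ w)
      go v (acc rec) pv with any? (λ w → P? w ×-dec v ⟶*? w ×-dec ¬? (w ≟ v))
      ... | no none = v , pv , ε , λ w pw v⟶*w →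
              decidable-stable (w ≟ v) (λ w≢v → none (w , pw , v⟶*w , w≢v))
      ... | yes (w , pw , v⟶*w , w≢v) with go w (rec (⟶*-≢⇒⟶⁺ v⟶*w (w≢v ∘ sym))) pw
      ...   | m , pm , w⟶*m , m-min = m , pm , v⟶*w ◅◅ w⟶*m , m-min

module _ (G : Digraph) where
  open Digraph G

  private
    infix 4 _≼_ _⊆ᶜ_
    _≼_ : Fin n → Fin n → Set
    _≼_ = Defs._≼_ G
    _⊆ᶜ_ : (Fin n → Set) → (Fin n → Set) → Set
    _⊆ᶜ_ = Defs._⊆ᶜ_ G

  C-mono : ∀ {u v} → u ≼ v → C G u ⊆ᶜ C G v
  C-mono u≼v x (leaf , x≼u) = leaf , u≼v ◅◅ x≼u

  hull⊆C-commonAnc : ∀ {A w} → (∀ x → x ∈ A → IsLeaf G x) → IsCommonAnc G A w →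
                     Hull G A ⊆ᶜ C G w
  hull⊆C-commonAnc A⊆X w-anc x (_ , x∈⋂) = x∈⋂ _ λ y y∈A → A⊆X y y∈A , w-anc y y∈A

  comparable-lcas-equal : ∀ {A w w′} → IsLCA G A w → IsLCA G A w′ → w ≼ w′ ⊎ w′ ≼ w → w ≡ w′
  comparable-lcas-equal (w-anc , _) (_ , w′-min) (inj₁ w≼w′) = w′-min _ w-anc w≼w′
  comparable-lcas-equal (_ , w-min) (w′-anc , _) (inj₂ w′≼w) = sym (w-min _ w′-anc w′≼w)

  module _ (dag : IsDAG G) where
    open Acyclic (λ u v → edge u v ≟ᵇ true) dag

    commonAnc? : ∀ A → U.Decidable (IsCommonAnc G A)
    commonAnc? A w = all? λ y → y ∈? A →-dec w ⟶*? y

    lca-below : ∀ {A v} → IsCommonAnc G A v → ∃ λ w → IsLCA G A w × w ≼ v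
    lca-below {A} v-anc with w , w-anc , v⟶*w , w-min ← minimal-below _ (commonAnc? A) v-anc
      = w , (w-anc , w-min) , v⟶*w

    lcaDefined⇒hull∈𝒞 : ∀ {A} → (∀ x → x ∈ A → IsLeaf G x) → LcaDefined G A → In𝒞 G (Hull G A)
    lcaDefined⇒hull∈𝒞 {A} A⊆X (w , (w-anc , _) , unique) =
      w , λ x → mk⇔ (hull⊆C-commonAnc A⊆X w-anc x) (C⊆hull x)
      where
        C⊆hull : C G w ⊆ᶜ Hull G A
        C⊆hull x (leaf , x≼w) = leaf , λ v A⊆Cv → leaf , w≼ v (λ y y∈A → proj₂ (A⊆Cv y y∈A)) ◅◅ x≼w
          where
            w≼ : ∀ v → IsCommonAnc G A v → w ≼ v
            w≼ v v-anc with lca-below v-anc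
            ... | w′ , w′-lca , w′≼v with unique w′ w′-lca
            ...   | refl = w′≼v

  module _ (pcc : PCC G) {A v} (A⊆X : ∀ x → x ∈ A → IsLeaf G x)
           (hull⇔Cv : ∀ x → Hull G A x ⇔ C G v x) where

    hull-commonAnc : IsCommonAnc G A v
    hull-commonAnc y y∈A = proj₂ (to (hull⇔Cv y) (A⊆X y y∈A , λ _ A⊆Cu → A⊆Cu y y∈A))

    hull⊆C-lca : ∀ {w} → IsLCA G A w → C G v ⊆ᶜ C G w
    hull⊆C-lca (w-anc , _) x x∈Cv = hull⊆C-commonAnc A⊆X w-anc x (from (hull⇔Cv x) x∈Cv)

    C-lca⊆hull : ∀ {w} → IsLCA G A w → C G w ⊆ᶜ C G v
    C-lca⊆hull {w} w-lca@(_ , w-min) with from (pcc v w) (inj₁ (hull⊆C-lca w-lca))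
    ... | inj₁ v≼w with refl ← w-min v hull-commonAnc v≼w = λ _ x∈Cw → x∈Cw
    ... | inj₂ w≼v = C-mono w≼v

    lca-unique : ∀ {w w′} → IsLCA G A w → IsLCA G A w′ → w ≡ w′
    lca-unique w-lca w′-lca = comparable-lcas-equal w-lca w′-lca
      (from (pcc _ _) (inj₁ λ x x∈Cw → hull⊆C-lca w′-lca x (C-lca⊆hull w-lca x x∈Cw)))

proposition3 : (G : Digraph) → IsDAG G → PCC G → (k : ℕ) → 1 ≤ k →
    KLcaProperty G k ⇔ PreKary G k
proposition3 G dag pcc k _ = mk⇔ lca⇒preKary preKary⇒lca
  where
    lca⇒preKary : KLcaProperty G k → PreKary G k
    lca⇒preKary lca U U∈Xᵏ = lcaDefined⇒hull∈𝒞 G dag (proj₁ U∈Xᵏ) (lca U U∈Xᵏ)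
    preKary⇒lca : PreKary G k → KLcaProperty G k
    preKary⇒lca preKary A A∈Xᵏ with v , hull⇔Cv ← preKary A A∈Xᵏ
      with w , w-lca , _ ← lca-below G dag (hull-commonAnc G pcc (proj₁ A∈Xᵏ) hull⇔Cv)
      = w , w-lca , λ w′ w′-lca → lca-unique G pcc (proj₁ A∈Xᵏ) hull⇔Cv w′-lca w-lca
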